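{- The class of claw-o-heavy and $N$-p-heavy graphs is c-stable.
   Context: All graphs are finite and simple; $n=|V(G)|$. A pair of nonadjacent vertices $\{u,v\}$ of $G$ is a heavy pair if $d(u)+d(v)\geq n$. $G$ is claw-o-heavy if every induced claw ($K_{1,3}$) of $G$ contains a heavy pair of $G$. The net $N$ is the graph consisting of a triangle $abc$ together with three pendant edges $aa_1$, $bb_1$, $cc_1$. An induced subgraph $M$ of $G$ isomorphic to $N$ (labelled this way) is p-heavy in $G$ if there are two vertices $u,v$ of $M$ with $d_G(u)+d_G(v)\geq n$ such that $\{u,v\}\notin\{\{a,a_1\},\{b,b_1\},\{c,c_1\}\}$; $G$ is $N$-p-heavy if every induced $N$ in $G$ is p-heavy. For a vertex $x$ of a claw-o-heavy graph $G$, let $G^*$ be the graph obtained from $G$ by adding the missing edges $uv$ with $u,v\in N(x)$ such that $\{u,v\}$ is a heavy pair of $G$; $x$ is c-eligible if $N(x)$ is not a clique and either $G^*[N(x)]$ is connected, or $G^*[N(x)]$ consists of two disjoint cliques $C_1,C_2$ and $x$ lies in a heavy pair $\{x,z\}$ of $G$ with $zy_1,zy_2\in E(G)$ for some $y_1\in C_1$, $y_2\in C_2$. The completion $G'_x$ is obtained from $G$ by adding all missing edges $uv$ with $u,v\in N(x)$. The c-closure of a claw-o-heavy graph $G$ is the (well-defined) graph obtained by repeatedly replacing the current graph by its completion at a c-eligible vertex until no c-eligible vertex remains. A family of graphs is c-stable if for every graph in the family, its c-closure is also in the family. -}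

module Defs where

open import Data.Nat using (ℕ; _+_; _≤_)
open import Data.Fin using (Fin; _≟_)
open import Data.Bool using (Bool; true; false; _∧_; _∨_; not; if_then_else_)
open import Data.Bool.Properties using (∧-comm; ∨-comm)
open import Data.List using (List; []; _∷_; map; allFin)
open import Data.Nat.ListAction using (sum)
open import Data.List.Membership.Propositional using (_∈_)
open import Data.List.Relation.Unary.Unique.Propositional using (Unique)
open import Data.Product using (Σ; ∃; _×_; _,_)
open import Data.Sum using (_⊎_)
open import Relation.Nullary using (¬_; yes; no)
open import Relation.Nullary.Decidable using (⌊_⌋)
open import Relation.Binary.PropositionalEquality using (_≡_; _≢_; refl; sym; cong; cong₂)

record Graph (n : ℕ) : Set where
  field
    adj    : Fin n → Fin n → Bool
    adj-sym : ∀ u v → adj u v ≡ adj v u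
    adj-irr : ∀ u → adj u u ≡ false
open Graph public

module _ {n : ℕ} (G : Graph n) where

  E : Fin n → Fin n → Set
  E u v = adj G u v ≡ true

  deg : Fin n → ℕ
  deg u = sum (map (λ v → if adj G u v then 1 else 0) (allFin n))

  HeavyPair : Fin n → Fin n → Set
  HeavyPair u v = u ≢ v × ¬ E u v × n ≤ deg u + deg v

  InducedClaw : Fin n → Fin n → Fin n → Fin n → Set
  InducedClaw x a b c =
    Unique (x ∷ a ∷ b ∷ c ∷ []) ×
    E x a × E x b × E x c ×
    ¬ E a b × ¬ E a c × ¬ E b c

  ClawOHeavy : Set
  ClawOHeavy = ∀ x a b c → InducedClaw x a b c →
    Σ (Fin n) λ u → Σ (Fin n) λ v →
      u ∈ (x ∷ a ∷ b ∷ c ∷ []) × v ∈ (x ∷ a ∷ b ∷ c ∷ []) × HeavyPair u v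

  InducedNet : (a b c a1 b1 c1 : Fin n) → Set
  InducedNet a b c a1 b1 c1 =
    Unique (a ∷ b ∷ c ∷ a1 ∷ b1 ∷ c1 ∷ []) ×
    (E a b × E b c × E a c × E a a1 × E b b1 × E c c1) ×
    (¬ E a b1 × ¬ E a c1 × ¬ E b a1 × ¬ E b c1 × ¬ E c a1 × ¬ E c b1 ×
     ¬ E a1 b1 × ¬ E a1 c1 × ¬ E b1 c1)

SamePair : {n : ℕ} → Fin n → Fin n → Fin n → Fin n → Set
SamePair u v p q = (u ≡ p × v ≡ q) ⊎ (u ≡ q × v ≡ p)

module _ {n : ℕ} (G : Graph n) where

  PHeavyNet : (a b c a1 b1 c1 : Fin n) → Set
  PHeavyNet a b c a1 b1 c1 =
    Σ (Fin n) λ u → Σ (Fin n) λ v →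
      u ∈ (a ∷ b ∷ c ∷ a1 ∷ b1 ∷ c1 ∷ []) ×
      v ∈ (a ∷ b ∷ c ∷ a1 ∷ b1 ∷ c1 ∷ []) ×
      u ≢ v ×
      n ≤ deg G u + deg G v ×
      ¬ SamePair u v a a1 × ¬ SamePair u v b b1 × ¬ SamePair u v c c1

  NPHeavy : Set
  NPHeavy = ∀ a b c a1 b1 c1 → InducedNet G a b c a1 b1 c1 → PHeavyNet a b c a1 b1 c1

  StarAdj : Fin n → Fin n → Fin n → Set
  StarAdj x u v = E G u v ⊎ (E G x u × E G x v × HeavyPair G u v)

data Reach {n : ℕ} (P : Fin n → Set) (R : Fin n → Fin n → Set) : Fin n → Fin n → Set where
  here : ∀ {u} → P u → Reach P R u u
  step : ∀ {u v w} → P u → R u v → Reach P R v w → Reach P R u w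

module _ {n : ℕ} (G : Graph n) where

  NbhdClique : Fin n → Set
  NbhdClique x = ∀ u v → E G x u → E G x v → u ≢ v → E G u v

  StarConnected : Fin n → Set
  StarConnected x = ∀ u v → E G x u → E G x v → Reach (E G x) (StarAdj G x) u v

  -- G*[N(x)] consists of two disjoint cliques C1 = {C ≡ true}, C2 = {C ≡ false},
  -- and x lies in a heavy pair {x,z} with z adjacent to some y1 ∈ C1, y2 ∈ C2
  TwoCliquesCase : Fin n → Set
  TwoCliquesCase x = Σ (Fin n → Bool) λ C →
    (∀ u v → E G x u → E G x v → u ≢ v → C u ≡ C v → StarAdj G x u v) ×
    (∀ u v → E G x u → E G x v → C u ≡ true → C v ≡ false → ¬ StarAdj G x u v) ×
    (Σ (Fin n) λ z → HeavyPair G x z ×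
      (Σ (Fin n) λ y1 → Σ (Fin n) λ y2 →
        E G x y1 × E G x y2 × C y1 ≡ true × C y2 ≡ false × E G z y1 × E G z y2))

  CEligible : Fin n → Set
  CEligible x = ¬ NbhdClique x × (StarConnected x ⊎ TwoCliquesCase x)

private
  neq : {n : ℕ} → Fin n → Fin n → Bool
  neq u v = not ⌊ u ≟ v ⌋

  neq-sym : {n : ℕ} (u v : Fin n) → neq u v ≡ neq v u
  neq-sym u v with u ≟ v | v ≟ u
  ... | yes _ | yes _ = refl
  ... | no _ | no _ = refl
  ... | yes p | no q = Data.Empty.⊥-elim (q (sym p))
    where import Data.Empty
  ... | no p | yes q = Data.Empty.⊥-elim (p (sym q))
    where import Data.Empty

  neq-irr : {n : ℕ} (u : Fin n) → neq u u ≡ false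
  neq-irr u with u ≟ u
  ... | yes _ = refl
  ... | no p = Data.Empty.⊥-elim (p refl)
    where import Data.Empty

completion : {n : ℕ} → Graph n → Fin n → Graph n
completion G x = record
  { adj = λ u v → adj G u v ∨ (adj G x u ∧ adj G x v ∧ neq u v)
  ; adj-sym = λ u v → cong₂ _∨_ (adj-sym G u v)
      (trans3 u v)
  ; adj-irr = λ u → cong₂ _∨_ (adj-irr G u) (lem u)
  }
  where
  open import Relation.Binary.PropositionalEquality using (trans)
  trans3 : ∀ u v → (adj G x u ∧ adj G x v ∧ neq u v) ≡ (adj G x v ∧ adj G x u ∧ neq v u)
  trans3 u v with adj G x u | adj G x v
  ... | false | false = refl
  ... | false | true = refl
  ... | true | false = refl
  ... | true | true = neq-sym u v
  lem : ∀ u → (adj G x u ∧ adj G x u ∧ neq u u) ≡ false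
  lem u with adj G x u
  ... | false = refl
  ... | true = neq-irr u

data ClosureOf {n : ℕ} : Graph n → Graph n → Set where
  stop : ∀ {G} → (∀ x → ¬ CEligible G x) → ClosureOf G G
  step : ∀ {G H} x → CEligible G x → ClosureOf (completion G x) H → ClosureOf G H

module Submission where

-- We prove more: completing a claw-o-heavy, N-p-heavy graph G at ANY vertex x
-- (eligible or not) yields a claw-o-heavy, N-p-heavy graph G' = G'_x; the
-- theorem then follows by induction along the closure sequence.
--
-- Two degree facts drive everything (both from "N_G[s] ⊆ N_H[t] ⇒ d_G(s) ≤ d_H(t)"):
-- degrees do not drop, and d_G(x) ≤ d_{G'}(u) for every u ∈ N_G(x).  Given an
-- induced claw or net of G', either it is already induced in G, or some of its
-- edges are new; a new edge has both ends in N_G(x), which forces most other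
-- vertices outside N_G(x), and then x can be substituted for one vertex to get
-- an induced claw or net of G (or a claw of G appears inside the net).  Its heavy
-- pair is carried back to G' along a map of positions that sends admissible pairs
-- to admissible pairs and does not decrease degrees ("configurations" below;
-- admissibility of such maps is checked by evaluation).

open import Defs
open import Data.Nat using (ℕ; zero; suc; _+_; _≤_; z≤n; s≤s)
import Data.Nat.Properties
open Data.Nat.Properties using (≤-reflexive; ≤-trans; +-mono-≤; +-cancelʳ-≤; m≤n+m)
open import Algebra.Properties.CommutativeSemigroup Data.Nat.Properties.+-commutativeSemigroup
  using (interchange)
open import Data.Fin using (Fin; zero; suc; #_)
open import Data.Fin.Properties using (_≟_; all?)
open import Data.Bool using (Bool; true; false; if_then_else_; not; T; _∧_)
import Data.Bool.Properties
open Data.Bool.Properties using (T-∧)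
open import Data.Empty using (⊥-elim)
open import Data.Product using (Σ; _×_; _,_; proj₁; proj₂)
open import Data.Sum using (_⊎_; inj₁; inj₂; [_,_]′)
open import Data.List using (List; []; _∷_; map; allFin; tabulate; length; lookup)
open import Data.List.Properties using (map-tabulate)
open import Data.Nat.ListAction using (sum)
open import Data.List.Relation.Unary.All as All using ([]; _∷_)
open import Data.List.Relation.Unary.Any as Any using (here; there)
open import Data.List.Relation.Unary.Any.Properties using (lookup-index)
open import Data.List.Relation.Unary.AllPairs using (AllPairs; []; _∷_)
open import Data.List.Relation.Unary.Unique.Propositional using (Unique)
open import Data.List.Membership.Propositional using (_∈_)
open import Data.List.Membership.Propositional.Properties using (∈-lookup)
open import Function using (case_of_; _∘_)
open import Function.Bundles using (Equivalence)
open import Relation.Nullary using (¬_; Dec; yes; no; does)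
open import Relation.Nullary.Decidable using (dec-true; T?; _→-dec_; from-yes)
open import Relation.Binary.Definitions using (Symmetric)
open import Relation.Binary.PropositionalEquality using (_≡_; _≢_; refl; sym; trans; cong; ≢-sym)

𝟙[_] : Bool → ℕ
𝟙[ b ] = if b then 1 else 0

sum-mono : ∀ {A : Set} (xs : List A) {f g : A → ℕ} → (∀ w → f w ≤ g w) →
  sum (map f xs) ≤ sum (map g xs)
sum-mono []       f≤g = z≤n
sum-mono (x ∷ xs) f≤g = +-mono-≤ (f≤g x) (sum-mono xs f≤g)

sum-+ : ∀ {A : Set} (xs : List A) (f g : A → ℕ) →
  sum (map (λ w → f w + g w) xs) ≡ sum (map f xs) + sum (map g xs)
sum-+ []       f g = refl
sum-+ (x ∷ xs) f g =
  trans (cong ((f x + g x) +_) (sum-+ xs f g)) (interchange (f x) (g x) (sum (map f xs)) (sum (map g xs)))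

count-self : ∀ {n} (v : Fin n) → sum (map (λ w → 𝟙[ does (v ≟ w) ]) (allFin n)) ≡ 1
count-self {n} v = trans (cong sum (map-tabulate (λ w → w) (λ w → 𝟙[ does (v ≟ w) ]))) (go v)
  where
  zeros : ∀ k → sum (tabulate {n = k} (λ _ → 0)) ≡ 0
  zeros zero    = refl
  zeros (suc k) = zeros k
  go : ∀ {k} (v : Fin k) → sum (tabulate (λ w → 𝟙[ does (v ≟ w) ])) ≡ 1
  go {suc k} zero    = cong suc (zeros k)
  go {suc k} (suc v) = go v

module _ {n : ℕ} where

  ClosedNbr : Graph n → Fin n → Fin n → Set
  ClosedNbr H t w = E H t w ⊎ t ≡ w

  private
    closed-count-≥1 : (H : Graph n) (t w : Fin n) → ClosedNbr H t w →
      1 ≤ 𝟙[ adj H t w ] + 𝟙[ does (t ≟ w) ]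
    closed-count-≥1 H t w (inj₁ e)    rewrite e = s≤s z≤n
    closed-count-≥1 H t w (inj₂ refl) rewrite dec-true (t ≟ t) refl = m≤n+m 1 _

  deg-≤ : (G H : Graph n) (s t : Fin n) → (∀ w → ClosedNbr G s w → ClosedNbr H t w) →
    deg G s ≤ deg H t
  deg-≤ G H s t sub = +-cancelʳ-≤ 1 (deg G s) (deg H t) (begin
    deg G s + 1                                 ≡⟨ cong (deg G s +_) (sym (count-self s)) ⟩
    sum (map f (allFin n)) + sum (map δs (allFin n)) ≡⟨ sym (sum-+ (allFin n) f δs) ⟩
    sum (map (λ w → f w + δs w) (allFin n))     ≤⟨ sum-mono (allFin n) pointwise ⟩
    sum (map (λ w → g w + δt w) (allFin n))     ≡⟨ sum-+ (allFin n) g δt ⟩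
    sum (map g (allFin n)) + sum (map δt (allFin n)) ≡⟨ cong (deg H t +_) (count-self t) ⟩
    deg H t + 1                                 ∎)
    where
    open Data.Nat.Properties.≤-Reasoning
    f g δs δt : Fin n → ℕ
    f w = 𝟙[ adj G s w ]
    g w = 𝟙[ adj H t w ]
    δs w = 𝟙[ does (s ≟ w) ]
    δt w = 𝟙[ does (t ≟ w) ]
    pointwise : ∀ w → f w + δs w ≤ g w + δt w
    pointwise w with s ≟ w
    ... | yes refl rewrite adj-irr G s = closed-count-≥1 H t s (sub s (inj₂ refl))
    ... | no _ with adj G s w in e
    ...   | true  = closed-count-≥1 H t w (sub w (inj₁ e))
    ...   | false = z≤n

module _ {n : ℕ} (H : Graph n) where

  E? : (u v : Fin n) → Dec (E H u v)
  E? u v = adj H u v Data.Bool.Properties.≟ true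

  E-sym : ∀ {u v} → E H u v → E H v u
  E-sym {u} {v} e = trans (adj-sym H v u) e

  ¬E-sym : ∀ {u v} → ¬ E H u v → ¬ E H v u
  ¬E-sym ne e = ne (E-sym e)

  E⇒≢ : ∀ {u v} → E H u v → u ≢ v
  E⇒≢ {u} e refl with () ← trans (sym e) (adj-irr H u)

  separated : ∀ {s u v} → E H s u → ¬ E H s v → u ≢ v
  separated e ne refl = ne e

module Completion {n : ℕ} (G : Graph n) (x : Fin n) where

  G' : Graph n
  G' = completion G x

  edge-kept : ∀ {u v} → E G u v → E G' u v
  edge-kept e rewrite e = refl

  nonedge-reflected : ∀ {u v} → ¬ E G' u v → ¬ E G u v
  nonedge-reflected ne e = ne (edge-kept e)

  edge-added : ∀ {u v} → E G x u → E G x v → u ≢ v → E G' u v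
  edge-added {u} {v} xu xv u≢v rewrite xu | xv with u ≟ v
  ... | yes u≡v = ⊥-elim (u≢v u≡v)
  ... | no _ with adj G u v
  ...   | true  = refl
  ...   | false = refl

  new-edge-ends : ∀ {u v} → E G' u v → ¬ E G u v → E G x u × E G x v
  new-edge-ends {u} {v} e' ne with adj G u v | adj G x u | adj G x v | e'
  ... | true  | _     | _     | _ = ⊥-elim (ne refl)
  ... | false | true  | true  | _ = refl , refl
  ... | false | true  | false | ()
  ... | false | false | _     | ()

  edge-outside : ∀ {u v} → E G' u v → ¬ E G x v → E G u v
  edge-outside {u} {v} e' x≁v with E? G u v
  ... | yes e  = e
  ... | no  ne = ⊥-elim (x≁v (proj₂ (new-edge-ends e' ne)))

  deg-grows : ∀ v → deg G v ≤ deg G' v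
  deg-grows v = deg-≤ G G' v v λ where
    w (inj₁ e)   → inj₁ (edge-kept e)
    w (inj₂ v≡w) → inj₂ v≡w

  -- a neighbour u of x sees all of N_G[x] in G'_x, hence d_G(x) ≤ d_{G'}(u)
  deg-centre : ∀ {u} → E G x u → deg G x ≤ deg G' u
  deg-centre {u} xu = deg-≤ G G' x u λ where
    w (inj₂ refl) → inj₁ (edge-kept (E-sym G xu))
    w (inj₁ xw)   → case u ≟ w of λ where
      (yes u≡w) → inj₂ u≡w
      (no  u≢w) → inj₁ (edge-added xu xw u≢w)

lookup-AllPairs : ∀ {A : Set} {R : A → A → Set} → Symmetric R → ∀ {xs} → AllPairs R xs →
  ∀ {i j} → i ≢ j → R (lookup xs i) (lookup xs j)
lookup-AllPairs R-sym (_  ∷ _)   {zero}  {zero}  i≢j = ⊥-elim (i≢j refl)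
lookup-AllPairs R-sym (px ∷ _)   {zero}  {suc j} _   = All.lookup px (∈-lookup j)
lookup-AllPairs R-sym (px ∷ _)   {suc i} {zero}  _   = R-sym (All.lookup px (∈-lookup i))
lookup-AllPairs R-sym (_  ∷ pxs) {suc i} {suc j} i≢j = lookup-AllPairs R-sym pxs (i≢j ∘ cong suc)

lookup-injective : ∀ {A : Set} {xs : List A} → Unique xs → ∀ {i j} → lookup xs i ≡ lookup xs j → i ≡ j
lookup-injective u {i} {j} eq with i ≟ j
... | yes i≡j = i≡j
... | no  i≢j = ⊥-elim (lookup-AllPairs ≢-sym u i≢j eq)

position : ∀ {A : Set} {xs : List A} {u : A} → u ∈ xs → Σ (Fin (length xs)) λ i → u ≡ lookup xs i
position u∈xs = Any.index u∈xs , lookup-index u∈xs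

distinct : ∀ {k} → Fin k → Fin k → Bool
distinct i j = not (does (i ≟ j))

distinct-intro : ∀ {k} {i j : Fin k} → i ≢ j → T (distinct i j)
distinct-intro {i = i} {j} i≢j with i ≟ j
... | yes i≡j = i≢j i≡j
... | no  _   = _

distinct-elim : ∀ {k} {i j : Fin k} → T (distinct i j) → i ≢ j
distinct-elim {i = i} {j} d with i ≟ j
... | yes _   = ⊥-elim d
... | no  i≢j = i≢j

PairMap : ∀ {k l} → (Fin k → Fin k → Bool) → (Fin l → Fin l → Bool) → (Fin k → Fin l) → Set
PairMap R S g = ∀ i j → T (R i j) → T (S (g i) (g j))

-- decidable, so concrete instances are checked by evaluation (from-yes)
pair-map? : ∀ {k l} (R : Fin k → Fin k → Bool) (S : Fin l → Fin l → Bool) g → Dec (PairMap R S g)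
pair-map? R S g = all? λ i → all? λ j → T? (R i j) →-dec T? (S (g i) (g j))

module _ {n : ℕ} where

  Heavy : ∀ {k} → Graph n → (Fin k → Fin n) → (Fin k → Fin k → Bool) → Set
  Heavy {k} G V R = Σ (Fin k) λ i → Σ (Fin k) λ j → T (R i j) × n ≤ deg G (V i) + deg G (V j)

  heavy-transfer : ∀ {k l} {G H : Graph n} {V : Fin k → Fin n} {W : Fin l → Fin n}
    {R : Fin k → Fin k → Bool} {S : Fin l → Fin l → Bool} (g : Fin k → Fin l) →
    PairMap R S g → (∀ i → deg G (V i) ≤ deg H (W (g i))) → Heavy G V R → Heavy H W S
  heavy-transfer g g-ok dom (i , j , r , h) =
    g i , g j , g-ok i j r , ≤-trans h (+-mono-≤ (dom i) (dom j))

  heavy-mono : ∀ {k} {G H : Graph n} {V W : Fin k → Fin n} {R : Fin k → Fin k → Bool} →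
    (∀ i → deg G (V i) ≤ deg H (W i)) → Heavy G V R → Heavy H W R
  heavy-mono {G = G} {H} = heavy-transfer {G = G} {H = H} (λ i → i) (λ _ _ r → r)

  heavy-relabel : ∀ {k l} {H : Graph n} {V : Fin k → Fin n} {W : Fin l → Fin n}
    {R : Fin k → Fin k → Bool} {S : Fin l → Fin l → Bool} (g : Fin k → Fin l) →
    PairMap R S g → (∀ i → V i ≡ W (g i)) → Heavy H V R → Heavy H W S
  heavy-relabel {H = H} g g-ok same =
    heavy-transfer {G = H} {H = H} g g-ok (λ i → ≤-reflexive (cong (deg H) (same i)))

  members-heavy : ∀ {G : Graph n} {xs : List (Fin n)} {u v} → u ∈ xs → v ∈ xs → u ≢ v →
    n ≤ deg G u + deg G v → Heavy G (lookup xs) distinct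
  members-heavy {G} {xs} u∈xs v∈xs u≢v h with position u∈xs | position v∈xs
  ... | i , refl | j , refl = i , j , distinct-intro (u≢v ∘ cong (lookup xs)) , h

record Claw {n : ℕ} (H : Graph n) (w p q r : Fin n) : Set where
  field
    p≢q : p ≢ q
    p≢r : p ≢ r
    q≢r : q ≢ r
    w∼p : E H w p
    w∼q : E H w q
    w∼r : E H w r
    p≁q : ¬ E H p q
    p≁r : ¬ E H p r
    q≁r : ¬ E H q r

leaves : ∀ {n} → Fin n → Fin n → Fin n → List (Fin n)
leaves p q r = p ∷ q ∷ r ∷ []

HeavyPairIn : ∀ {n} → Graph n → List (Fin n) → Set
HeavyPairIn {n} H xs = Σ (Fin n) λ u → Σ (Fin n) λ v → u ∈ xs × v ∈ xs × HeavyPair H u v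

module _ {n : ℕ} {H : Graph n} {w p q r : Fin n} where

  -- the record form of an induced claw, and back (the centre is distinct from
  -- the leaves as it is adjacent to them)
  claw-from : InducedClaw H w p q r → Claw H w p q r
  claw-from (_ ∷ (p≢q ∷ p≢r ∷ []) ∷ (q≢r ∷ []) ∷ [] ∷ [] , w∼p , w∼q , w∼r , p≁q , p≁r , q≁r) =
    record { p≢q = p≢q ; p≢r = p≢r ; q≢r = q≢r ; w∼p = w∼p ; w∼q = w∼q ; w∼r = w∼r
           ; p≁q = p≁q ; p≁r = p≁r ; q≁r = q≁r }

  module _ (C : Claw H w p q r) where
    open Claw C

    claw-to : InducedClaw H w p q r
    claw-to = (E⇒≢ H w∼p ∷ E⇒≢ H w∼q ∷ E⇒≢ H w∼r ∷ []) ∷ (p≢q ∷ p≢r ∷ []) ∷ (q≢r ∷ []) ∷ [] ∷ [] ,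
              w∼p , w∼q , w∼r , p≁q , p≁r , q≁r

    spokes : All.All (E H w) (leaves p q r)
    spokes = w∼p ∷ w∼q ∷ w∼r ∷ []

    leaves-unique : Unique (leaves p q r)
    leaves-unique = (p≢q ∷ p≢r ∷ []) ∷ (q≢r ∷ []) ∷ [] ∷ []

    leaves-independent : AllPairs (λ u v → ¬ E H u v) (leaves p q r)
    leaves-independent = (p≁q ∷ p≁r ∷ []) ∷ (q≁r ∷ []) ∷ [] ∷ []

    -- the centre is adjacent to every leaf, so a heavy pair of a claw is a pair of leaves
    claw-heavy : ClawOHeavy H → Heavy H (lookup (leaves p q r)) distinct
    claw-heavy co with co w p q r claw-to
    ... | _ , _ , here refl , here refl , u≢v , _   , _ = ⊥-elim (u≢v refl)
    ... | _ , _ , here refl , there v∈  , _   , u≁v , _ = ⊥-elim (u≁v (All.lookup spokes v∈))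
    ... | _ , _ , there u∈  , here refl , _   , u≁v , _ = ⊥-elim (u≁v (E-sym H (All.lookup spokes u∈)))
    ... | _ , _ , there u∈  , there v∈  , u≢v , _   , h = members-heavy {G = H} u∈ v∈ u≢v h

    claw-pair : Heavy H (lookup (leaves p q r)) distinct → HeavyPairIn H (w ∷ leaves p q r)
    claw-pair (i , j , i≠j , h) =
      lookup (leaves p q r) i , lookup (leaves p q r) j , there (∈-lookup i) , there (∈-lookup j) ,
      lookup-AllPairs ≢-sym leaves-unique i≢j , lookup-AllPairs (¬E-sym H) leaves-independent i≢j , h
      where
      i≢j : i ≢ j
      i≢j = distinct-elim i≠j

module _ {n : ℕ} {H : Graph n} {w p q r : Fin n} (C : Claw H w p q r) where
  open Claw C

  claw-swap-pq : Claw H w q p r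
  claw-swap-pq = record { p≢q = ≢-sym p≢q ; p≢r = q≢r ; q≢r = p≢r ; w∼p = w∼q ; w∼q = w∼p ; w∼r = w∼r
                        ; p≁q = ¬E-sym H p≁q ; p≁r = q≁r ; q≁r = p≁r }

  claw-swap-pr : Claw H w r q p
  claw-swap-pr = record { p≢q = ≢-sym q≢r ; p≢r = ≢-sym p≢r ; q≢r = ≢-sym p≢q ; w∼p = w∼r ; w∼q = w∼q
                        ; w∼r = w∼p ; p≁q = ¬E-sym H q≁r ; p≁r = ¬E-sym H p≁r ; q≁r = ¬E-sym H p≁q }

module _ {n : ℕ} {H : Graph n} {p q r : Fin n} where

  leaves-swap-pq : Heavy H (lookup (leaves q p r)) distinct → Heavy H (lookup (leaves p q r)) distinct
  leaves-swap-pq = heavy-relabel {H = H} σ (from-yes (pair-map? distinct distinct σ))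
    (λ { zero → refl ; (suc zero) → refl ; (suc (suc zero)) → refl })
    where
    σ : Fin 3 → Fin 3
    σ = lookup (# 1 ∷ # 0 ∷ # 2 ∷ [])

  leaves-swap-pr : Heavy H (lookup (leaves r q p)) distinct → Heavy H (lookup (leaves p q r)) distinct
  leaves-swap-pr = heavy-relabel {H = H} σ (from-yes (pair-map? distinct distinct σ))
    (λ { zero → refl ; (suc zero) → refl ; (suc (suc zero)) → refl })
    where
    σ : Fin 3 → Fin 3
    σ = lookup (# 2 ∷ # 1 ∷ # 0 ∷ [])

module ClawPreservation {n : ℕ} (G : Graph n) (x : Fin n) (co : ClawOHeavy G) where
  open Completion G x

  old-claw : ∀ {w p q r} → Claw G' w p q r → E G w p → E G w q → E G w r →
    Heavy G' (lookup (leaves p q r)) distinct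
  old-claw C w∼p w∼q w∼r = heavy-mono {G = G} {H = G'}
    (λ { zero → deg-grows _ ; (suc zero) → deg-grows _ ; (suc (suc zero)) → deg-grows _ })
    (claw-heavy C-in-G co)
    where
    open Claw C using (p≢q; p≢r; q≢r; p≁q; p≁r; q≁r)
    C-in-G : Claw G _ _ _ _
    C-in-G = record { p≢q = p≢q ; p≢r = p≢r ; q≢r = q≢r ; w∼p = w∼p ; w∼q = w∼q ; w∼r = w∼r
                    ; p≁q = nonedge-reflected p≁q ; p≁r = nonedge-reflected p≁r
                    ; q≁r = nonedge-reflected q≁r }

  -- new spoke wp: then w, p ∈ N_G(x) while q, r ∉ N_G(x), so x replaces p
  -- in a claw of G with centre w, and d_G(x) ≤ d_{G'}(p)
  new-spoke : ∀ {w p q r} → Claw G' w p q r → ¬ E G w p → Heavy G' (lookup (leaves p q r)) distinct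
  new-spoke {w} {p} {q} {r} C w≁p = heavy-mono {G = G} {H = G'}
    (λ { zero → deg-centre x∼p ; (suc zero) → deg-grows q ; (suc (suc zero)) → deg-grows r })
    (claw-heavy C-in-G co)
    where
    open Claw C
    x∼w = proj₁ (new-edge-ends w∼p w≁p)
    x∼p = proj₂ (new-edge-ends w∼p w≁p)
    x≁q : ¬ E G x q
    x≁q x∼q = p≁q (edge-added x∼p x∼q p≢q)
    x≁r : ¬ E G x r
    x≁r x∼r = p≁r (edge-added x∼p x∼r p≢r)
    p∼x : E G' p x
    p∼x = edge-kept (E-sym G x∼p)
    C-in-G : Claw G w x q r
    C-in-G = record { p≢q = separated G' p∼x p≁q ; p≢r = separated G' p∼x p≁r ; q≢r = q≢r
                    ; w∼p = E-sym G x∼w ; w∼q = edge-outside w∼q x≁q ; w∼r = edge-outside w∼r x≁r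
                    ; p≁q = x≁q ; p≁r = x≁r ; q≁r = nonedge-reflected q≁r }

  leaves-heavy : ∀ {w p q r} → Claw G' w p q r → Heavy G' (lookup (leaves p q r)) distinct
  leaves-heavy {w} {p} {q} {r} C with E? G w p | E? G w q | E? G w r
  ... | no w≁p | _       | _       = new-spoke C w≁p
  ... | yes _  | no w≁q  | _       = leaves-swap-pq {H = G'} (new-spoke (claw-swap-pq C) w≁q)
  ... | yes _  | yes _   | no w≁r  = leaves-swap-pr {H = G'} (new-spoke (claw-swap-pr C) w≁r)
  ... | yes w∼p | yes w∼q | yes w∼r = old-claw C w∼p w∼q w∼r

  claw-o-heavy : ClawOHeavy G'
  claw-o-heavy w p q r cl = claw-pair C (leaves-heavy C)
    where C = claw-from cl

record Net {n : ℕ} (H : Graph n) (a b c a₁ b₁ c₁ : Fin n) : Set where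
  field
    a∼b : E H a b
    b∼c : E H b c
    a∼c : E H a c
    a∼a₁ : E H a a₁
    b∼b₁ : E H b b₁
    c∼c₁ : E H c c₁
    a≁b₁ : ¬ E H a b₁
    a≁c₁ : ¬ E H a c₁
    b≁a₁ : ¬ E H b a₁
    b≁c₁ : ¬ E H b c₁
    c≁a₁ : ¬ E H c a₁
    c≁b₁ : ¬ E H c b₁
    a₁≁b₁ : ¬ E H a₁ b₁
    a₁≁c₁ : ¬ E H a₁ c₁
    b₁≁c₁ : ¬ E H b₁ c₁

net-vertices : ∀ {n} (a b c a₁ b₁ c₁ : Fin n) → List (Fin n)
net-vertices a b c a₁ b₁ c₁ = a ∷ b ∷ c ∷ a₁ ∷ b₁ ∷ c₁ ∷ []

module _ {n : ℕ} {H : Graph n} {a b c a₁ b₁ c₁ : Fin n} where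

  -- the record form of an induced net (distinctness is recovered below)
  net-from : InducedNet H a b c a₁ b₁ c₁ → Net H a b c a₁ b₁ c₁
  net-from (_ , (a∼b , b∼c , a∼c , a∼a₁ , b∼b₁ , c∼c₁) ,
               (a≁b₁ , a≁c₁ , b≁a₁ , b≁c₁ , c≁a₁ , c≁b₁ , a₁≁b₁ , a₁≁c₁ , b₁≁c₁)) = record
    { a∼b = a∼b ; b∼c = b∼c ; a∼c = a∼c ; a∼a₁ = a∼a₁ ; b∼b₁ = b∼b₁ ; c∼c₁ = c∼c₁
    ; a≁b₁ = a≁b₁ ; a≁c₁ = a≁c₁ ; b≁a₁ = b≁a₁ ; b≁c₁ = b≁c₁ ; c≁a₁ = c≁a₁ ; c≁b₁ = c≁b₁
    ; a₁≁b₁ = a₁≁b₁ ; a₁≁c₁ = a₁≁c₁ ; b₁≁c₁ = b₁≁c₁ }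

  module _ (N : Net H a b c a₁ b₁ c₁) where
    open Net N

    -- the net has no twins: adjacent vertices differ, and every nonadjacent
    -- pair is separated by a third vertex of the net
    net-unique : Unique (net-vertices a b c a₁ b₁ c₁)
    net-unique =
      (E⇒≢ H a∼b ∷ E⇒≢ H a∼c ∷ E⇒≢ H a∼a₁ ∷ separated H c∼a c≁b₁ ∷ separated H b∼a b≁c₁ ∷ []) ∷
      (E⇒≢ H b∼c ∷ separated H c∼b c≁a₁ ∷ E⇒≢ H b∼b₁ ∷ separated H a∼b a≁c₁ ∷ []) ∷
      (separated H b∼c b≁a₁ ∷ separated H a∼c a≁b₁ ∷ E⇒≢ H c∼c₁ ∷ []) ∷
      (separated H a∼a₁ a≁b₁ ∷ separated H a∼a₁ a≁c₁ ∷ []) ∷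
      (separated H b∼b₁ b≁c₁ ∷ []) ∷
      [] ∷ []
      where
      b∼a = E-sym H a∼b
      c∼a = E-sym H a∼c
      c∼b = E-sym H b∼c

    net-distinct : ∀ i j → i ≢ j →
      lookup (net-vertices a b c a₁ b₁ c₁) i ≢ lookup (net-vertices a b c a₁ b₁ c₁) j
    net-distinct i j = lookup-AllPairs ≢-sym net-unique

    net-to : InducedNet H a b c a₁ b₁ c₁
    net-to = net-unique , (a∼b , b∼c , a∼c , a∼a₁ , b∼b₁ , c∼c₁) ,
             (a≁b₁ , a≁c₁ , b≁a₁ , b≁c₁ , c≁a₁ , c≁b₁ , a₁≁b₁ , a₁≁c₁ , b₁≁c₁)

    net-swap-ab : Net H b a c b₁ a₁ c₁
    net-swap-ab = record
      { a∼b = E-sym H a∼b ; b∼c = a∼c ; a∼c = b∼c ; a∼a₁ = b∼b₁ ; b∼b₁ = a∼a₁ ; c∼c₁ = c∼c₁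
      ; a≁b₁ = b≁a₁ ; a≁c₁ = b≁c₁ ; b≁a₁ = a≁b₁ ; b≁c₁ = a≁c₁ ; c≁a₁ = c≁b₁ ; c≁b₁ = c≁a₁
      ; a₁≁b₁ = ¬E-sym H a₁≁b₁ ; a₁≁c₁ = b₁≁c₁ ; b₁≁c₁ = a₁≁c₁ }

    net-swap-ac : Net H c b a c₁ b₁ a₁
    net-swap-ac = record
      { a∼b = E-sym H b∼c ; b∼c = E-sym H a∼b ; a∼c = E-sym H a∼c ; a∼a₁ = c∼c₁ ; b∼b₁ = b∼b₁ ; c∼c₁ = a∼a₁
      ; a≁b₁ = c≁b₁ ; a≁c₁ = c≁a₁ ; b≁a₁ = b≁c₁ ; b≁c₁ = b≁a₁ ; c≁a₁ = a≁c₁ ; c≁b₁ = a≁b₁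
      ; a₁≁b₁ = ¬E-sym H b₁≁c₁ ; a₁≁c₁ = ¬E-sym H a₁≁c₁ ; b₁≁c₁ = ¬E-sym H a₁≁b₁ }

-- positions 0..5 hold a, b, c, a₁, b₁, c₁; the pendant partner of a position
mate : Fin 6 → Fin 6
mate = lookup (# 3 ∷ # 4 ∷ # 5 ∷ # 0 ∷ # 1 ∷ # 2 ∷ [])

-- admissible pairs for p-heaviness: distinct and not a pendant edge
admissible : Fin 6 → Fin 6 → Bool
admissible i j = distinct i j ∧ distinct j (mate i)

module _ {n : ℕ} {H : Graph n} {a b c a₁ b₁ c₁ : Fin n} where
  private
    V : Fin 6 → Fin n
    V = lookup (net-vertices a b c a₁ b₁ c₁)

    mate-pendant : ∀ i → SamePair (V i) (V (mate i)) a a₁ ⊎ SamePair (V i) (V (mate i)) b b₁ ⊎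
                         SamePair (V i) (V (mate i)) c c₁
    mate-pendant zero                                = inj₁ (inj₁ (refl , refl))
    mate-pendant (suc zero)                          = inj₂ (inj₁ (inj₁ (refl , refl)))
    mate-pendant (suc (suc zero))                    = inj₂ (inj₂ (inj₁ (refl , refl)))
    mate-pendant (suc (suc (suc zero)))              = inj₁ (inj₂ (refl , refl))
    mate-pendant (suc (suc (suc (suc zero))))        = inj₂ (inj₁ (inj₂ (refl , refl)))
    mate-pendant (suc (suc (suc (suc (suc zero))))) = inj₂ (inj₂ (inj₂ (refl , refl)))

  net-heavy : PHeavyNet H a b c a₁ b₁ c₁ → Heavy H V admissible
  net-heavy (u , v , u∈ , v∈ , u≢v , h , ¬aa₁ , ¬bb₁ , ¬cc₁) with position u∈ | position v∈
  ... | i , refl | j , refl =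
    i , j , Equivalence.from T-∧ (distinct-intro {i = i} {j} (u≢v ∘ cong V) , distinct-intro not-mate) , h
    where
    not-mate : j ≢ mate i
    not-mate refl = [ ¬aa₁ , [ ¬bb₁ , ¬cc₁ ]′ ]′ (mate-pendant i)

  -- ... and conversely, since the vertices of a net sit at unique positions
  net-p-heavy : Net H a b c a₁ b₁ c₁ → Heavy H V admissible → PHeavyNet H a b c a₁ b₁ c₁
  net-p-heavy N (i , j , adm , h) =
    V i , V j , ∈-lookup i , ∈-lookup j ,
    lookup-AllPairs ≢-sym U (distinct-elim {i = i} {j} (proj₁ (Equivalence.to T-∧ adm))) , h ,
    not-pendant (# 0) (# 3) (λ ()) (λ ()) , not-pendant (# 1) (# 4) (λ ()) (λ ()) ,
    not-pendant (# 2) (# 5) (λ ()) (λ ())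
    where
    U = net-unique N
    not-pendant : ∀ k l → ¬ T (admissible k l) → ¬ T (admissible l k) → ¬ SamePair (V i) (V j) (V k) (V l)
    not-pendant k l kl̸ lk̸ (inj₁ (i≡k , j≡l)) with lookup-injective U {i} {k} i≡k | lookup-injective U {j} {l} j≡l
    ... | refl | refl = kl̸ adm
    not-pendant k l kl̸ lk̸ (inj₂ (i≡l , j≡k)) with lookup-injective U {i} {l} i≡l | lookup-injective U {j} {k} j≡k
    ... | refl | refl = lk̸ adm

module _ {n : ℕ} {H : Graph n} {a b c a₁ b₁ c₁ : Fin n} where

  heavy-swap-ab : Heavy H (lookup (net-vertices b a c b₁ a₁ c₁)) admissible →
    Heavy H (lookup (net-vertices a b c a₁ b₁ c₁)) admissible
  heavy-swap-ab = heavy-relabel {H = H} σ (from-yes (pair-map? admissible admissible σ))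
    (λ { zero → refl ; (suc zero) → refl ; (suc (suc zero)) → refl ; (suc (suc (suc zero))) → refl
       ; (suc (suc (suc (suc zero)))) → refl ; (suc (suc (suc (suc (suc zero))))) → refl })
    where
    σ : Fin 6 → Fin 6
    σ = lookup (# 1 ∷ # 0 ∷ # 2 ∷ # 4 ∷ # 3 ∷ # 5 ∷ [])

  heavy-swap-ac : Heavy H (lookup (net-vertices c b a c₁ b₁ a₁)) admissible →
    Heavy H (lookup (net-vertices a b c a₁ b₁ c₁)) admissible
  heavy-swap-ac = heavy-relabel {H = H} σ (from-yes (pair-map? admissible admissible σ))
    (λ { zero → refl ; (suc zero) → refl ; (suc (suc zero)) → refl ; (suc (suc (suc zero))) → refl
       ; (suc (suc (suc (suc zero)))) → refl ; (suc (suc (suc (suc (suc zero))))) → refl })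
    where
    σ : Fin 6 → Fin 6
    σ = lookup (# 2 ∷ # 1 ∷ # 0 ∷ # 5 ∷ # 4 ∷ # 3 ∷ [])

module NetPreservation {n : ℕ} (G : Graph n) (x : Fin n) (co : ClawOHeavy G) (np : NPHeavy G) where
  open Completion G x

  -- Net fields refer to adjacency in G'; where they are in scope, hypotheses
  -- about adjacency in G carry the mark ᴳ.

  HeavyNet : (a b c a₁ b₁ c₁ : Fin n) → Set
  HeavyNet a b c a₁ b₁ c₁ = Heavy G' (lookup (net-vertices a b c a₁ b₁ c₁)) admissible

  net-heavy-in-G : ∀ {a b c a₁ b₁ c₁} → Net G a b c a₁ b₁ c₁ →
    Heavy G (lookup (net-vertices a b c a₁ b₁ c₁)) admissible
  net-heavy-in-G N = net-heavy {H = G} (np _ _ _ _ _ _ (net-to N))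

  old-net : ∀ {a b c a₁ b₁ c₁} → Net G' a b c a₁ b₁ c₁ →
    E G a b → E G b c → E G a c → E G a a₁ → E G b b₁ → E G c c₁ → HeavyNet a b c a₁ b₁ c₁
  old-net N a∼b b∼c a∼c a∼a₁ b∼b₁ c∼c₁ = heavy-mono {G = G} {H = G'}
    (λ { zero → deg-grows _ ; (suc zero) → deg-grows _ ; (suc (suc zero)) → deg-grows _
       ; (suc (suc (suc zero))) → deg-grows _ ; (suc (suc (suc (suc zero)))) → deg-grows _
       ; (suc (suc (suc (suc (suc zero))))) → deg-grows _ })
    (net-heavy-in-G N-in-G)
    where
    open Net N using (a≁b₁; a≁c₁; b≁a₁; b≁c₁; c≁a₁; c≁b₁; a₁≁b₁; a₁≁c₁; b₁≁c₁)
    N-in-G : Net G _ _ _ _ _ _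
    N-in-G = record
      { a∼b = a∼b ; b∼c = b∼c ; a∼c = a∼c ; a∼a₁ = a∼a₁ ; b∼b₁ = b∼b₁ ; c∼c₁ = c∼c₁
      ; a≁b₁ = nonedge-reflected a≁b₁ ; a≁c₁ = nonedge-reflected a≁c₁ ; b≁a₁ = nonedge-reflected b≁a₁
      ; b≁c₁ = nonedge-reflected b≁c₁ ; c≁a₁ = nonedge-reflected c≁a₁ ; c≁b₁ = nonedge-reflected c≁b₁
      ; a₁≁b₁ = nonedge-reflected a₁≁b₁ ; a₁≁c₁ = nonedge-reflected a₁≁c₁
      ; b₁≁c₁ = nonedge-reflected b₁≁c₁ }

  -- new pendant edge a a₁: a, a₁ ∈ N_G(x) while b, c, b₁, c₁ ∉ N_G(x) (they
  -- are not adjacent to a₁ in G'), so x replaces a₁ in a net of G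
  new-pendant : ∀ {a b c a₁ b₁ c₁} → Net G' a b c a₁ b₁ c₁ → ¬ E G a a₁ → HeavyNet a b c a₁ b₁ c₁
  new-pendant {a} {b} {c} {a₁} {b₁} {c₁} N a≁ᴳa₁ = heavy-mono {G = G} {H = G'}
    (λ { zero → deg-grows a ; (suc zero) → deg-grows b ; (suc (suc zero)) → deg-grows c
       ; (suc (suc (suc zero))) → deg-centre x∼a₁ ; (suc (suc (suc (suc zero)))) → deg-grows b₁
       ; (suc (suc (suc (suc (suc zero))))) → deg-grows c₁ })
    (net-heavy-in-G N-in-G)
    where
    open Net N
    x∼a = proj₁ (new-edge-ends a∼a₁ a≁ᴳa₁)
    x∼a₁ = proj₂ (new-edge-ends a∼a₁ a≁ᴳa₁)
    outside : ∀ {v} → a₁ ≢ v → ¬ E G' a₁ v → ¬ E G x v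
    outside a₁≢v a₁≁v x∼v = a₁≁v (edge-added x∼a₁ x∼v a₁≢v)
    x≁b = outside (net-distinct N (# 3) (# 1) λ ()) (¬E-sym G' b≁a₁)
    x≁c = outside (net-distinct N (# 3) (# 2) λ ()) (¬E-sym G' c≁a₁)
    x≁b₁ = outside (net-distinct N (# 3) (# 4) λ ()) a₁≁b₁
    x≁c₁ = outside (net-distinct N (# 3) (# 5) λ ()) a₁≁c₁
    N-in-G : Net G a b c x b₁ c₁
    N-in-G = record
      { a∼b = edge-outside a∼b x≁b ; b∼c = edge-outside b∼c x≁c ; a∼c = edge-outside a∼c x≁c
      ; a∼a₁ = E-sym G x∼a ; b∼b₁ = edge-outside b∼b₁ x≁b₁ ; c∼c₁ = edge-outside c∼c₁ x≁c₁
      ; a≁b₁ = nonedge-reflected a≁b₁ ; a≁c₁ = nonedge-reflected a≁c₁ ; b≁a₁ = ¬E-sym G x≁b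
      ; b≁c₁ = nonedge-reflected b≁c₁ ; c≁a₁ = ¬E-sym G x≁c ; c≁b₁ = nonedge-reflected c≁b₁
      ; a₁≁b₁ = x≁b₁ ; a₁≁c₁ = x≁c₁ ; b₁≁c₁ = nonedge-reflected b₁≁c₁ }

  -- only the triangle edge bc is new: a is the centre of the claw (a; b, c, a₁) of G
  one-missing : ∀ {a b c a₁ b₁ c₁} → Net G' a b c a₁ b₁ c₁ →
    E G a b → E G a c → ¬ E G b c → E G a a₁ → HeavyNet a b c a₁ b₁ c₁
  one-missing N a∼ᴳb a∼ᴳc b≁ᴳc a∼ᴳa₁ = heavy-transfer {G = G} {H = G'} g (from-yes (pair-map? distinct admissible g))
    (λ { zero → deg-grows _ ; (suc zero) → deg-grows _ ; (suc (suc zero)) → deg-grows _ })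
    (claw-heavy C co)
    where
    open Net N using (b∼c; b≁a₁; c≁a₁)
    g : Fin 3 → Fin 6
    g = lookup (# 1 ∷ # 2 ∷ # 3 ∷ [])
    C : Claw G _ _ _ _
    C = record { p≢q = E⇒≢ G' b∼c ; p≢r = net-distinct N (# 1) (# 3) λ () ; q≢r = net-distinct N (# 2) (# 3) λ ()
               ; w∼p = a∼ᴳb ; w∼q = a∼ᴳc ; w∼r = a∼ᴳa₁
               ; p≁q = b≁ᴳc ; p≁r = nonedge-reflected b≁a₁ ; q≁r = nonedge-reflected c≁a₁ }

  -- the triangle edges ab, ac are new but bc is old: a, b, c ∈ N_G(x), and x
  -- takes the place of a in a net of G with a as its pendant vertex
  two-missing : ∀ {a b c a₁ b₁ c₁} → Net G' a b c a₁ b₁ c₁ →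
    ¬ E G a b → ¬ E G a c → E G b c → E G b b₁ → E G c c₁ → HeavyNet a b c a₁ b₁ c₁
  two-missing {a} {b} {c} {a₁} {b₁} {c₁} N a≁ᴳb a≁ᴳc b∼ᴳc b∼ᴳb₁ c∼ᴳc₁ =
    heavy-transfer {G = G} {H = G'} g (from-yes (pair-map? admissible admissible g))
    (λ { zero → deg-centre x∼a ; (suc zero) → deg-grows b ; (suc (suc zero)) → deg-grows c
       ; (suc (suc (suc zero))) → deg-grows a ; (suc (suc (suc (suc zero)))) → deg-grows b₁
       ; (suc (suc (suc (suc (suc zero))))) → deg-grows c₁ })
    (net-heavy-in-G N-in-G)
    where
    open Net N
    g : Fin 6 → Fin 6
    g = lookup (# 0 ∷ # 1 ∷ # 2 ∷ # 0 ∷ # 4 ∷ # 5 ∷ [])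
    x∼a = proj₁ (new-edge-ends a∼b a≁ᴳb)
    x∼b = proj₂ (new-edge-ends a∼b a≁ᴳb)
    x∼c = proj₂ (new-edge-ends a∼c a≁ᴳc)
    outside : ∀ {v} → a ≢ v → ¬ E G' a v → ¬ E G x v
    outside a≢v a≁v x∼v = a≁v (edge-added x∼a x∼v a≢v)
    N-in-G : Net G x b c a b₁ c₁
    N-in-G = record
      { a∼b = x∼b ; b∼c = b∼ᴳc ; a∼c = x∼c ; a∼a₁ = x∼a ; b∼b₁ = b∼ᴳb₁ ; c∼c₁ = c∼ᴳc₁
      ; a≁b₁ = outside (net-distinct N (# 0) (# 4) λ ()) a≁b₁
      ; a≁c₁ = outside (net-distinct N (# 0) (# 5) λ ()) a≁c₁
      ; b≁a₁ = ¬E-sym G a≁ᴳb ; b≁c₁ = nonedge-reflected b≁c₁ ; c≁a₁ = ¬E-sym G a≁ᴳc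
      ; c≁b₁ = nonedge-reflected c≁b₁ ; a₁≁b₁ = nonedge-reflected a≁b₁
      ; a₁≁c₁ = nonedge-reflected a≁c₁ ; b₁≁c₁ = nonedge-reflected b₁≁c₁ }

  -- all triangle edges new: x is the centre of the claw (x; a, b, c) of G
  all-missing : ∀ {a b c a₁ b₁ c₁} → Net G' a b c a₁ b₁ c₁ →
    ¬ E G a b → ¬ E G a c → ¬ E G b c → HeavyNet a b c a₁ b₁ c₁
  all-missing N a≁ᴳb a≁ᴳc b≁ᴳc = heavy-transfer {G = G} {H = G'} g (from-yes (pair-map? distinct admissible g))
    (λ { zero → deg-grows _ ; (suc zero) → deg-grows _ ; (suc (suc zero)) → deg-grows _ })
    (claw-heavy C co)
    where
    open Net N using (a∼b; a∼c; b∼c)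
    g : Fin 3 → Fin 6
    g = lookup (# 0 ∷ # 1 ∷ # 2 ∷ [])
    C : Claw G x _ _ _
    C = record { p≢q = E⇒≢ G' a∼b ; p≢r = E⇒≢ G' a∼c ; q≢r = E⇒≢ G' b∼c
               ; w∼p = proj₁ (new-edge-ends a∼b a≁ᴳb) ; w∼q = proj₂ (new-edge-ends a∼b a≁ᴳb)
               ; w∼r = proj₂ (new-edge-ends a∼c a≁ᴳc) ; p≁q = a≁ᴳb ; p≁r = a≁ᴳc ; q≁r = b≁ᴳc }

  old-pendants : ∀ {a b c a₁ b₁ c₁} → Net G' a b c a₁ b₁ c₁ →
    E G a a₁ → E G b b₁ → E G c c₁ → HeavyNet a b c a₁ b₁ c₁
  old-pendants {a} {b} {c} N a∼a₁ b∼b₁ c∼c₁ with E? G a b | E? G a c | E? G b c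
  ... | yes a∼b | yes a∼c | yes b∼c = old-net N a∼b b∼c a∼c a∼a₁ b∼b₁ c∼c₁
  ... | yes a∼b | yes a∼c | no  b≁c = one-missing N a∼b a∼c b≁c a∼a₁
  ... | yes a∼b | no  a≁c | yes b∼c =
    heavy-swap-ab {H = G'} (one-missing (net-swap-ab N) (E-sym G a∼b) b∼c a≁c b∼b₁)
  ... | no  a≁b | yes a∼c | yes b∼c =
    heavy-swap-ac {H = G'} (one-missing (net-swap-ac N) (E-sym G b∼c) (E-sym G a∼c) (¬E-sym G a≁b) c∼c₁)
  ... | no  a≁b | no  a≁c | yes b∼c = two-missing N a≁b a≁c b∼c b∼b₁ c∼c₁
  ... | no  a≁b | yes a∼c | no  b≁c =
    heavy-swap-ab {H = G'} (two-missing (net-swap-ab N) (¬E-sym G a≁b) b≁c a∼c a∼a₁ c∼c₁)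
  ... | yes a∼b | no  a≁c | no  b≁c =
    heavy-swap-ac {H = G'} (two-missing (net-swap-ac N) (¬E-sym G b≁c) (¬E-sym G a≁c) (E-sym G a∼b) b∼b₁ a∼a₁)
  ... | no  a≁b | no  a≁c | no  b≁c = all-missing N a≁b a≁c b≁c

  net-config-heavy : ∀ {a b c a₁ b₁ c₁} → Net G' a b c a₁ b₁ c₁ → HeavyNet a b c a₁ b₁ c₁
  net-config-heavy {a} {b} {c} {a₁} {b₁} {c₁} N with E? G a a₁ | E? G b b₁ | E? G c c₁
  ... | no  a≁a₁ | _        | _        = new-pendant N a≁a₁
  ... | yes _    | no  b≁b₁ | _        = heavy-swap-ab {H = G'} (new-pendant (net-swap-ab N) b≁b₁)
  ... | yes _    | yes _    | no  c≁c₁ = heavy-swap-ac {H = G'} (new-pendant (net-swap-ac N) c≁c₁)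
  ... | yes a∼a₁ | yes b∼b₁ | yes c∼c₁ = old-pendants N a∼a₁ b∼b₁ c∼c₁

  n-p-heavy : NPHeavy G'
  n-p-heavy a b c a₁ b₁ c₁ net = net-p-heavy N (net-config-heavy N)
    where N = net-from net

corollary8 : (n : ℕ) (G H : Graph n) → ClawOHeavy G → NPHeavy G → ClosureOf G H →
    ClawOHeavy H × NPHeavy H
corollary8 n G .G co np (stop _) = co , np
corollary8 n G H co np (step x _ closure) =
  corollary8 n (completion G x) H (ClawPreservation.claw-o-heavy G x co)
    (NetPreservation.n-p-heavy G x co np) closure
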